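{- Let $(s_{n,k})$ be defined by $s_{n,n}=1$ for $n\ge0$, $s_{n,k}=0$ for $n<k$ or $n<0$ or $k<0$, and $s_{n,k}=s_{n-1,k-1}+3s_{n-1,k}+2s_{n-1,k+1}$ otherwise (for $n>k\ge0$). Then for all integers $m\ge n\ge 0$, $$\sum_{k=0}^{m}2^k\,\mathrm{per}\begin{pmatrix}s_{n,k}&s_{n,k+1}\\ s_{m,k}&s_{m,k+1}\end{pmatrix}=s_{m+n,1}.$$
   Context: $\mathrm{per}\begin{pmatrix}a&b\\c&d\end{pmatrix}=ad+bc$. -}

module Defs where

open import Data.Nat using (ℕ; zero; suc; _+_; _*_; _^_)
open import Data.List using (map; upTo)
open import Data.Nat.ListAction using (sum)

-- Negative indices are 0 by convention; the
-- recursion below agrees with the paper's definition (s_{n,n}=1,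
-- s_{n,k}=0 for n<k, and the three-term recursion for n>k≥0), since
-- for suc n ≤ suc k the right-hand side evaluates to the correct value.
s : ℕ → ℕ → ℕ
s zero zero = 1
s zero (suc k) = 0
s (suc n) zero = 3 * s n 0 + 2 * s n 1
s (suc n) (suc k) = s n k + 3 * s n (suc k) + 2 * s n (suc (suc k))

per : ℕ → ℕ → ℕ → ℕ → ℕ
per a b c d = a * d + b * c

sumTo : ℕ → (ℕ → ℕ) → ℕ
sumTo m f = sum (map f (upTo (suc m)))

-- Write (T u)ₖ = uₖ₋₁ + 3uₖ + 2uₖ₊₁ (with u₋₁ = 0), so that s (n + 1) = T (s n), and
-- ⟨u , v⟩ = Σₖ 2ᵏ (uₖ vₖ₊₁ + uₖ₊₁ vₖ).  The weights 2ᵏ make T self-adjoint for this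
-- form: termwise ⟨T u , v⟩ and ⟨u , T v⟩ differ by a telescoping boundary term, which
-- vanishes for finitely supported sequences.  Hence ⟨s n , s m⟩ = ⟨s 0 , s (m + n)⟩,
-- and since s 0 is the indicator of 0 the right-hand side is s (m + n) 1.
module Submission where

open import Defs
open import Data.Nat using (ℕ; zero; suc; _+_; _*_; _^_; _≤_; _<_; s≤s)
open import Data.Nat.Properties
  using (+-identityʳ; *-identityˡ; *-zeroʳ; +-suc; +-comm; +-cancelʳ-≡; m≤n+m; m<n⇒m<1+n;
         m≤n⇒m≤1+n; m<n⇒m≤1+n; ≤-refl; ≤-reflexive; ≤-trans; m+n≤o⇒m≤o; m+n≤o⇒n≤o)
open import Data.List using (map; upTo; _++_; [_])
open import Data.List.Properties using (upTo-∷ʳ; map-++)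
open import Data.Nat.ListAction using (sum)
open import Data.Nat.ListAction.Properties using (sum-++)
open import Data.Nat.Tactic.RingSolver using (solve-∀)
open import Relation.Binary.PropositionalEquality
  using (_≡_; refl; sym; trans; cong; cong₂; _≗_; module ≡-Reasoning)

Σ : ℕ → (ℕ → ℕ) → ℕ
Σ zero f = f 0
Σ (suc N) f = Σ N f + f (suc N)

sumTo≡Σ : ∀ N f → sumTo N f ≡ Σ N f
sumTo≡Σ zero f = +-identityʳ (f 0)
sumTo≡Σ (suc N) f = begin
  sum (map f (upTo (suc (suc N))))             ≡⟨ cong (λ l → sum (map f l)) (sym (upTo-∷ʳ (suc N))) ⟩
  sum (map f (upTo (suc N) ++ [ suc N ]))      ≡⟨ cong sum (map-++ f (upTo (suc N)) [ suc N ]) ⟩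
  sum (map f (upTo (suc N)) ++ [ f (suc N) ])  ≡⟨ sum-++ (map f (upTo (suc N))) [ f (suc N) ] ⟩
  sum (map f (upTo (suc N))) + (f (suc N) + 0) ≡⟨ cong₂ _+_ (sumTo≡Σ N f) (+-identityʳ (f (suc N))) ⟩
  Σ N f + f (suc N)                            ∎
  where open ≡-Reasoning

Σ-cong : ∀ N {f g} → f ≗ g → Σ N f ≡ Σ N g
Σ-cong zero f≗g = f≗g 0
Σ-cong (suc N) f≗g = cong₂ _+_ (Σ-cong N f≗g) (f≗g (suc N))

Σ-extend : ∀ m d f → (∀ k → m < k → f k ≡ 0) → Σ (d + m) f ≡ Σ m f
Σ-extend m zero f vanish = refl
Σ-extend m (suc d) f vanish = begin
  Σ (d + m) f + f (suc (d + m)) ≡⟨ cong₂ _+_ (Σ-extend m d f vanish) (vanish _ (s≤s (m≤n+m m d))) ⟩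
  Σ m f + 0                     ≡⟨ +-identityʳ _ ⟩
  Σ m f                         ∎
  where open ≡-Reasoning

-- Telescoping with the boundary term split as e − p, so that no subtraction occurs.
Σ-telescope : ∀ N (f g p e : ℕ → ℕ) →
  (∀ k → f k + p k + e (suc k) ≡ g k + e k + p (suc k)) →
  Σ N f + p 0 + e (suc N) ≡ Σ N g + e 0 + p (suc N)
Σ-telescope zero f g p e step = step 0
Σ-telescope (suc N) f g p e step = +-cancelʳ-≡ (e (suc N) + p (suc N)) _ _ (begin
  Σ N f + f (suc N) + p 0 + e (suc (suc N)) + (e (suc N) + p (suc N))
    ≡⟨ regroup (Σ N f) (p 0) (e (suc N)) (f (suc N)) (p (suc N)) (e (suc (suc N))) ⟩
  (Σ N f + p 0 + e (suc N)) + (f (suc N) + p (suc N) + e (suc (suc N)))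
    ≡⟨ cong₂ _+_ (Σ-telescope N f g p e step) (step (suc N)) ⟩
  (Σ N g + e 0 + p (suc N)) + (g (suc N) + e (suc N) + p (suc (suc N)))
    ≡⟨ sym (regroup (Σ N g) (e 0) (p (suc N)) (g (suc N)) (e (suc N)) (p (suc (suc N)))) ⟩
  Σ N g + g (suc N) + e 0 + p (suc (suc N)) + (p (suc N) + e (suc N))
    ≡⟨ cong (Σ N g + g (suc N) + e 0 + p (suc (suc N)) +_) (+-comm (p (suc N)) (e (suc N))) ⟩
  Σ N g + g (suc N) + e 0 + p (suc (suc N)) + (e (suc N) + p (suc N)) ∎)
  where
  open ≡-Reasoning
  regroup : ∀ a b c x y z → a + x + b + z + (c + y) ≡ (a + b + c) + (x + y + z)
  regroup = solve-∀

prev : (ℕ → ℕ) → ℕ → ℕ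
prev u zero = 0
prev u (suc k) = u k

next : (ℕ → ℕ) → ℕ → ℕ
next u k = prev u k + 3 * u k + 2 * u (suc k)

s-suc : ∀ n → s (suc n) ≗ next (s n)
s-suc n zero = refl
s-suc n (suc k) = refl

s-vanishes : ∀ {n k} → n < k → s n k ≡ 0
s-vanishes {zero} {suc k} _ = refl
s-vanishes {suc n} {suc k} (s≤s n<k)
  rewrite s-vanishes n<k
        | s-vanishes (m<n⇒m<1+n n<k)
        | s-vanishes (m<n⇒m<1+n (m<n⇒m<1+n n<k)) = refl

perTerm : (ℕ → ℕ) → (ℕ → ℕ) → ℕ → ℕ
perTerm u v k = 2 ^ k * per (u k) (u (suc k)) (v k) (v (suc k))

perTerm-congˡ : ∀ {u u′} v → u ≗ u′ → perTerm u v ≗ perTerm u′ v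
perTerm-congˡ v u≗u′ k = cong₂ (λ x y → 2 ^ k * per x y (v k) (v (suc k))) (u≗u′ k) (u≗u′ (suc k))

perTerm-congʳ : ∀ u {v v′} → v ≗ v′ → perTerm u v ≗ perTerm u v′
perTerm-congʳ u v≗v′ k = cong₂ (λ x y → 2 ^ k * per (u k) (u (suc k)) x y) (v≗v′ k) (v≗v′ (suc k))

-- The termwise step of next-selfAdjoint, with w = 2ᵏ, aᵢ = uₖ₋₁₊ᵢ and bᵢ = vₖ₋₁₊ᵢ.
next-adjoint-identity : ∀ w a₀ a₁ a₂ a₃ b₀ b₁ b₂ b₃ →
  w * ((a₀ + 3 * a₁ + 2 * a₂) * b₂ + (a₁ + 3 * a₂ + 2 * a₃) * b₁) + w * (b₀ * a₂) + 2 * w * (a₁ * b₃)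
    ≡ w * (a₁ * (b₁ + 3 * b₂ + 2 * b₃) + a₂ * (b₀ + 3 * b₁ + 2 * b₂)) + w * (a₀ * b₂) + 2 * w * (b₁ * a₃)
next-adjoint-identity = solve-∀

next-selfAdjoint : ∀ N u v → u (suc (suc N)) ≡ 0 → v (suc (suc N)) ≡ 0 →
  Σ N (perTerm (next u) v) ≡ Σ N (perTerm u (next v))
-- p 0 and e 0 reduce to 0 because prev u 0 = prev v 0 = 0.
next-selfAdjoint N u v u-vanishes v-vanishes = begin
  Σ N (perTerm (next u) v)                   ≡⟨ sym (+-identityʳ _) ⟩
  Σ N (perTerm (next u) v) + p 0             ≡⟨ sym (+-identityʳ _) ⟩
  Σ N (perTerm (next u) v) + p 0 + 0         ≡⟨ cong (Σ N (perTerm (next u) v) + p 0 +_) (sym e-end) ⟩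
  Σ N (perTerm (next u) v) + p 0 + e (suc N) ≡⟨ Σ-telescope N _ _ p e termwise ⟩
  Σ N (perTerm u (next v)) + e 0 + p (suc N) ≡⟨ cong (Σ N (perTerm u (next v)) + e 0 +_) p-end ⟩
  Σ N (perTerm u (next v)) + e 0 + 0         ≡⟨ +-identityʳ _ ⟩
  Σ N (perTerm u (next v)) + e 0             ≡⟨ +-identityʳ _ ⟩
  Σ N (perTerm u (next v))                   ∎
  where
  open ≡-Reasoning
  p e : ℕ → ℕ
  p k = 2 ^ k * (prev v k * u (suc k))
  e k = 2 ^ k * (prev u k * v (suc k))
  termwise : ∀ k → perTerm (next u) v k + p k + e (suc k) ≡ perTerm u (next v) k + e k + p (suc k)
  termwise k = next-adjoint-identity (2 ^ k) (prev u k) (u k) (u (suc k)) (u (suc (suc k)))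
                                             (prev v k) (v k) (v (suc k)) (v (suc (suc k)))
  e-end : e (suc N) ≡ 0
  e-end rewrite v-vanishes | *-zeroʳ (u N) = *-zeroʳ (2 ^ suc N)
  p-end : p (suc N) ≡ 0
  p-end rewrite u-vanishes | *-zeroʳ (v N) = *-zeroʳ (2 ^ suc N)

Σ-perTerm-s₀ : ∀ N v → Σ N (perTerm (s 0) v) ≡ v 1
Σ-perTerm-s₀ zero v = trans (*-identityˡ _) (trans (+-identityʳ (1 * v 1)) (*-identityˡ (v 1)))
Σ-perTerm-s₀ (suc N) v = trans (cong₂ _+_ (Σ-perTerm-s₀ N v) (*-zeroʳ (2 ^ suc N))) (+-identityʳ (v 1))

Σ-perTerm-s : ∀ N n m → n + m ≤ N → Σ N (perTerm (s n) (s m)) ≡ s (n + m) 1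
Σ-perTerm-s N zero m _ = Σ-perTerm-s₀ N (s m)
Σ-perTerm-s N (suc n) m sn+m≤N = begin
  Σ N (perTerm (s (suc n)) (s m))    ≡⟨ Σ-cong N (perTerm-congˡ (s m) (s-suc n)) ⟩
  Σ N (perTerm (next (s n)) (s m))   ≡⟨ next-selfAdjoint N (s n) (s m) (s-vanishes (s≤s n≤N+1)) (s-vanishes (s≤s m≤N+1)) ⟩
  Σ N (perTerm (s n) (next (s m)))   ≡⟨ sym (Σ-cong N (perTerm-congʳ (s n) (s-suc m))) ⟩
  Σ N (perTerm (s n) (s (suc m)))    ≡⟨ Σ-perTerm-s N n (suc m) (≤-trans (≤-reflexive (+-suc n m)) sn+m≤N) ⟩
  s (n + suc m) 1                    ≡⟨ cong (λ x → s x 1) (+-suc n m) ⟩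
  s (suc n + m) 1                    ∎
  where
  open ≡-Reasoning
  n≤N+1 : n ≤ suc N
  n≤N+1 = m<n⇒m≤1+n (m+n≤o⇒m≤o (suc n) sn+m≤N)
  m≤N+1 : m ≤ suc N
  m≤N+1 = m≤n⇒m≤1+n (m+n≤o⇒n≤o (suc n) sn+m≤N)

corollary2p3 : (m n : ℕ) → n ≤ m →
    sumTo m (λ k → 2 ^ k * per (s n k) (s n (suc k)) (s m k) (s m (suc k)))
      ≡ s (m + n) 1
corollary2p3 m n _ = begin
  sumTo m (perTerm (s n) (s m))   ≡⟨ sumTo≡Σ m (perTerm (s n) (s m)) ⟩
  Σ m (perTerm (s n) (s m))       ≡⟨ sym (Σ-extend m n (perTerm (s n) (s m)) vanish) ⟩
  Σ (n + m) (perTerm (s n) (s m)) ≡⟨ Σ-perTerm-s (n + m) n m ≤-refl ⟩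
  s (n + m) 1                     ≡⟨ cong (λ x → s x 1) (+-comm n m) ⟩
  s (m + n) 1                     ∎
  where
  open ≡-Reasoning
  vanish : ∀ k → m < k → perTerm (s n) (s m) k ≡ 0
  vanish k m<k rewrite s-vanishes m<k | s-vanishes (m<n⇒m<1+n m<k)
                     | *-zeroʳ (s n k) | *-zeroʳ (s n (suc k)) = *-zeroʳ (2 ^ k)
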